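{- Fix $n\ge 3$ and a set $X$ of $n$ taxa. For unrooted binary trees $T_1,T_2$ with leaf set $X$, let $d(T_1,T_2)$ be the unique $k$ such that $T_1$ and $T_2$ precisely satisfy $k$-interval cospeciation, i.e. $d(T_1,T_2)=\max_{A,B\in X}\lvert \varepsilon_{T_1}(A,B)-\varepsilon_{T_2}(A,B)\rvert$. Then $d$ is a distance (tree metric) on the set of unrooted binary trees with leaf set $X$.
   Context: An unrooted binary tree is a tree in which every non-leaf vertex has degree three; its leaves are labeled by taxa. For a tree $T$ and taxa $A,B$, $\varepsilon_T(A,B)$ denotes the number of edges on the path between $A$ and $B$ in $T$ (branch lengths are ignored). Two trees $T_1,T_2$ on corresponding taxa satisfy $k$-interval cospeciation ($k$-IC) if $\lvert \varepsilon_{T_1}(A,B)-\varepsilon_{T_2}(a,b)\rvert\le k$ for all pairs of taxa $A,B$ with corresponding taxa $a,b$; here the correspondence is the identity on $X$. They precisely satisfy $k$-IC if they satisfy $k$-IC but not $(k-1)$-IC. -}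

module Defs where

open import Data.Nat using (ℕ; zero; suc; _+_; _*_; _∸_; _⊔_; ∣_-_∣)
open import Data.Bool using (Bool; true; false; if_then_else_; _∧_; _∨_)
open import Data.Fin using (Fin; _↑ˡ_; _↑ʳ_; _≟_)
open import Data.List using (List; allFin; map; foldr)
open import Data.Nat.ListAction using (sum)
open import Data.Bool.ListAction using (any)
open import Data.Product using (Σ; _×_)
open import Relation.Nullary.Decidable using (isYes)
open import Relation.Binary.PropositionalEquality using (_≡_)
open import Function.Bundles using (_↔_; Inverse)

Adj : ℕ → Set
Adj N = Fin N → Fin N → Bool

deg : {N : ℕ} → Adj N → Fin N → ℕ
deg {N} adj u = sum (map (λ v → if adj u v then 1 else 0) (allFin N))

-- sum of all degrees (= twice the number of edges for a simple graph)
degSum : {N : ℕ} → Adj N → ℕ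
degSum {N} adj = sum (map (deg adj) (allFin N))

reach : {N : ℕ} → Adj N → ℕ → Fin N → Fin N → Bool
reach adj zero    u v = isYes (u ≟ v)
reach {N} adj (suc k) u v =
  reach adj k u v ∨ any (λ w → reach adj k u w ∧ adj w v) (allFin N)

distGo : {N : ℕ} → Adj N → Fin N → Fin N → ℕ → ℕ → ℕ
distGo adj u v zero    k = k
distGo adj u v (suc f) k = if reach adj k u v then k else distGo adj u v f (suc k)

dist : {N : ℕ} → Adj N → Fin N → Fin N → ℕ
dist {N} adj u v = distGo adj u v N 0

-- Unrooted binary tree with leaf set X = Fin n.
-- Vertex set Fin (n + m): the first n vertices (a ↑ˡ m, a : Fin n) are the leaves,
-- labelled by the taxa a; the remaining m vertices are internal.
record UBTree (n : ℕ) : Set where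
  field
    m      : ℕ
    adj    : Adj (n + m)
    irrefl : ∀ u → adj u u ≡ false
    sym    : ∀ u v → adj u v ≡ adj v u
    -- tree: connected, and #edges = #vertices - 1
    conn   : ∀ u v → reach adj (n + m) u v ≡ true
    edges  : degSum adj ≡ 2 * ((n + m) ∸ 1)
    leafDeg     : ∀ (a : Fin n) → deg adj (a ↑ˡ m) ≡ 1
    internalDeg : ∀ (i : Fin m) → deg adj (n ↑ʳ i) ≡ 3

open UBTree

ε : {n : ℕ} → UBTree n → Fin n → Fin n → ℕ
ε T A B = dist (adj T) (A ↑ˡ m T) (B ↑ˡ m T)

maxList : List ℕ → ℕ
maxList = foldr _⊔_ 0

d : {n : ℕ} → UBTree n → UBTree n → ℕ
d {n} T₁ T₂ =
  maxList (map (λ A → maxList (map (λ B → ∣ ε T₁ A B - ε T₂ A B ∣) (allFin n))) (allFin n))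

_≅_ : {n : ℕ} → UBTree n → UBTree n → Set
_≅_ {n} T₁ T₂ = Σ (Fin (n + m T₁) ↔ Fin (n + m T₂)) λ f →
  (∀ (a : Fin n) → Inverse.to f (a ↑ˡ m T₁) ≡ a ↑ˡ m T₂) ×
  (∀ u v → adj T₂ (Inverse.to f u) (Inverse.to f v) ≡ adj T₁ u v)

module Submission where

-- Symmetry and the triangle inequality hold termwise for ∣x − y∣ and pass to
-- the maximum.  Isomorphism invariance and "d = 0 ⇒ isomorphic" are about
-- trees: an isomorphism preserves walks and hence ε, and conversely a tree is
-- determined by its leaf-to-leaf distances.

open import Defs
open import Data.Nat using (ℕ; _≤_; _+_)
open import Data.Product using (_×_)
open import Function.Bundles using (_⇔_)
open import Relation.Binary.PropositionalEquality using (_≡_)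

open import Data.Nat using (zero; suc; _<_; _∸_; _*_; z≤n; s≤s; _<?_; ∣_-_∣)
open import Data.Nat.Properties hiding (_≟_)
open import Data.Fin using (Fin; zero; suc; _↑ˡ_; _↑ʳ_; splitAt; fromℕ<)
open import Data.Fin.Properties using (_≟_; splitAt⁻¹-↑ˡ; splitAt⁻¹-↑ʳ)
open import Data.Bool using (Bool; true; false; if_then_else_; _∧_; _∨_)
open import Data.Bool.ListAction using (any)
open import Data.List using (map; allFin; tabulate)
open import Data.Nat.ListAction using (sum)
open import Data.Product using (Σ; _,_; proj₁; proj₂)
open import Data.Sum using (_⊎_; inj₁; inj₂)
open import Data.Empty using (⊥-elim)
open import Relation.Nullary using (¬_; Dec; yes; no; does)
open import Relation.Binary.PropositionalEquality
  using (_≢_; refl; sym; trans; cong; cong₂; subst; subst₂; module ≡-Reasoning)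
open import Function using (_∘_; id)
open import Function.Bundles using (_↔_; mk⇔; Equivalence; Inverse; mk↔ₛ′)
open import Function.Properties.Equivalence using () renaming (trans to ⇔-trans; sym to ⇔-sym)
open import Algebra.Properties.CommutativeMonoid.Sum +-0-commutativeMonoid
  using (sum-syntax; ∑-distrib-+; ∑-comm; sum-cong-≗; sum-replicate-zero)
  renaming (sum to ∑)

sum-allFin : ∀ N (f : Fin N → ℕ) → sum (map f (allFin N)) ≡ ∑[ i < N ] f i
sum-allFin N f = go f id
  where
  go : ∀ {A : Set} {N} (f : A → ℕ) (g : Fin N → A) → sum (map f (tabulate g)) ≡ ∑ (f ∘ g)
  go {N = zero}  f g = refl
  go {N = suc N} f g = cong (f (g zero) +_) (go f (g ∘ suc))

term≤∑ : ∀ {N} (f : Fin N → ℕ) i → f i ≤ ∑ f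
term≤∑ f zero    = m≤m+n _ _
term≤∑ f (suc i) = ≤-trans (term≤∑ (f ∘ suc) i) (m≤n+m _ _)

two-terms≤∑ : ∀ {N} (f : Fin N → ℕ) i j → i ≢ j → f i + f j ≤ ∑ f
two-terms≤∑ f zero    zero    i≢j = ⊥-elim (i≢j refl)
two-terms≤∑ f zero    (suc j) i≢j = +-monoʳ-≤ (f zero) (term≤∑ (f ∘ suc) j)
two-terms≤∑ f (suc i) zero    i≢j =
  subst (_≤ ∑ f) (+-comm (f zero) _) (+-monoʳ-≤ (f zero) (term≤∑ (f ∘ suc) i))
two-terms≤∑ f (suc i) (suc j) i≢j =
  ≤-trans (two-terms≤∑ (f ∘ suc) i j (i≢j ∘ cong suc)) (m≤n+m _ _)

∑-positive : ∀ {N} (f : Fin N → ℕ) → 1 ≤ ∑ f → Σ (Fin N) λ i → 1 ≤ f i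
∑-positive {suc N} f 1≤∑ with f zero in f₀≡
... | suc _ = zero , subst (1 ≤_) (sym f₀≡) (s≤s z≤n)
... | zero with ∑-positive (f ∘ suc) 1≤∑
...   | i , 1≤fi = suc i , 1≤fi

∑-mono : ∀ {N} (f g : Fin N → ℕ) → (∀ i → f i ≤ g i) → ∑ f ≤ ∑ g
∑-mono {zero}  f g f≤g = z≤n
∑-mono {suc N} f g f≤g = +-mono-≤ (f≤g zero) (∑-mono (f ∘ suc) (g ∘ suc) (f≤g ∘ suc))

∑-tight : ∀ {N} (f g : Fin N → ℕ) → (∀ i → f i ≤ g i) → ∑ g ≤ ∑ f → ∀ i → g i ≡ f i
∑-tight {suc N} f g f≤g ∑g≤∑f = agree
  where
  rest : ∑ (f ∘ suc) ≤ ∑ (g ∘ suc)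
  rest = ∑-mono (f ∘ suc) (g ∘ suc) (f≤g ∘ suc)
  head : g zero ≡ f zero
  head = ≤-antisym (+-cancelʳ-≤ _ _ _ (≤-trans ∑g≤∑f (+-monoʳ-≤ (f zero) rest))) (f≤g zero)
  agree : ∀ i → g i ≡ f i
  agree zero    = head
  agree (suc i) = ∑-tight (f ∘ suc) (g ∘ suc) (f≤g ∘ suc)
    (+-cancelˡ-≤ (g zero) _ _ (subst (λ z → _ ≤ z + _) (sym head) ∑g≤∑f)) i

others : ∀ {N} → Fin N → Fin N → ℕ
others r v = if does (v ≟ r) then 0 else 1

others-≢ : ∀ {N} (r v : Fin N) → v ≢ r → others r v ≡ 1
others-≢ r v v≢r with v ≟ r
... | yes v≡r = ⊥-elim (v≢r v≡r)
... | no  _   = refl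

∑-others : ∀ N (r : Fin N) → ∑ (others r) ≡ N ∸ 1
∑-others (suc N)       zero    = ∑-ones N
  where
  ∑-ones : ∀ N → ∑[ i < N ] 1 ≡ N
  ∑-ones zero    = refl
  ∑-ones (suc N) = cong suc (∑-ones N)
∑-others (suc (suc N)) (suc r) = cong suc (∑-others (suc N) r)

false≢true : false ≢ true
false≢true ()

∨-true : ∀ {x y} → x ∨ y ≡ true → x ≡ true ⊎ y ≡ true
∨-true {true}  _ = inj₁ refl
∨-true {false} e = inj₂ e

∨-trueʳ : ∀ {x y} → y ≡ true → x ∨ y ≡ true
∨-trueʳ {true}  _ = refl
∨-trueʳ {false} e = e

∧-true : ∀ {x y} → x ∧ y ≡ true → x ≡ true × y ≡ true
∧-true {true} e = refl , e

true-iff⇒≡ : ∀ {a b : Bool} → (a ≡ true → b ≡ true) → (b ≡ true → a ≡ true) → a ≡ b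
true-iff⇒≡ {true}  {true}  _ _ = refl
true-iff⇒≡ {false} {false} _ _ = refl
true-iff⇒≡ {true}  {false} a⇒b _   = ⊥-elim (false≢true (a⇒b refl))
true-iff⇒≡ {false} {true}  _   b⇒a = ⊥-elim (false≢true (b⇒a refl))

any-allFin : ∀ {N} (p : Fin N → Bool) → (Σ (Fin N) λ i → p i ≡ true) ⇔ (any p (allFin N) ≡ true)
any-allFin p = mk⇔ (λ (i , pi) → intro p id i pi) (elim p id)
  where
  intro : ∀ {A : Set} {N} (p : A → Bool) (g : Fin N → A) i → p (g i) ≡ true → any p (tabulate g) ≡ true
  intro p g zero    e rewrite e = refl
  intro p g (suc i) e = ∨-trueʳ {p (g zero)} (intro p (g ∘ suc) i e)
  elim : ∀ {A : Set} {N} (p : A → Bool) (g : Fin N → A) → any p (tabulate g) ≡ true → Σ (Fin N) λ i → p (g i) ≡ true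
  elim {N = zero}  p g ()
  elim {N = suc N} p g e with ∨-true {p (g zero)} e
  ... | inj₁ e₀ = zero , e₀
  ... | inj₂ eₛ with elim p (g ∘ suc) eₛ
  ...   | i , ei = suc i , ei

module Walks {N : ℕ} (adj : Adj N) where

  Reach : ℕ → Fin N → Fin N → Set
  Reach k u v = reach adj k u v ≡ true

  reach-zero : ∀ u v → Reach 0 u v → u ≡ v
  reach-zero u v e with u ≟ v
  ... | yes u≡v = u≡v

  reach-refl : ∀ u → Reach 0 u u
  reach-refl u with u ≟ u
  ... | yes _  = refl
  ... | no u≢u = ⊥-elim (u≢u refl)

  reach-suc : ∀ k u v → Reach k u v → Reach (suc k) u v
  reach-suc k u v e rewrite e = refl

  reach-step : ∀ k u w v → Reach k u w → adj w v ≡ true → Reach (suc k) u v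
  reach-step k u w v e a =
    ∨-trueʳ {reach adj k u v} (Equivalence.to (any-allFin _) (w , subst (λ b → b ∧ adj w v ≡ true) (sym e) a))

  reach-split : ∀ k u v → Reach (suc k) u v → Reach k u v ⊎ Σ (Fin N) λ w → Reach k u w × adj w v ≡ true
  reach-split k u v e with ∨-true {reach adj k u v} e
  ... | inj₁ short = inj₁ short
  ... | inj₂ last with Equivalence.from (any-allFin _) last
  ...   | w , ew = inj₂ (w , ∧-true ew)

  reach-trans : ∀ a b u w v → Reach a u w → Reach b w v → Reach (a + b) u v
  reach-trans a zero u w v e₁ e₂ with reach-zero w v e₂
  ... | refl = subst (λ k → Reach k u w) (sym (+-identityʳ a)) e₁
  reach-trans a (suc b) u w v e₁ e₂ =
    subst (λ k → Reach k u v) (sym (+-suc a b)) (extend (reach-split b w v e₂))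
    where
    extend : Reach b w v ⊎ (Σ (Fin N) λ z → Reach b w z × adj z v ≡ true) → Reach (suc (a + b)) u v
    extend (inj₁ short)          = reach-suc (a + b) u v (reach-trans a b u w v e₁ short)
    extend (inj₂ (z , ez , zv))  = reach-step (a + b) u z v (reach-trans a b u w z e₁ ez) zv

  distGo-least : ∀ {u v} f k {j} → Reach j u v → k ≤ j → distGo adj u v f k ≤ j
  distGo-least zero          k r k≤j = k≤j
  distGo-least {u} {v} (suc f) k r k≤j with reach adj k u v in e
  ... | true  = k≤j
  ... | false = distGo-least f (suc k) r (≤∧≢⇒< k≤j λ { refl → false≢true (trans (sym e) r) })

  distGo-reaches : ∀ {u v} f k → Reach (k + f) u v → Reach (distGo adj u v f k) u v
  distGo-reaches {u} {v} zero    k r = subst (λ j → Reach j u v) (+-identityʳ k) r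
  distGo-reaches {u} {v} (suc f) k r with reach adj k u v in e
  ... | true  = e
  ... | false = distGo-reaches f (suc k) (subst (λ j → Reach j u v) (+-suc k f) r)

  distGo-bound : ∀ u v f k → distGo adj u v f k ≤ k + f
  distGo-bound u v zero    k = ≤-reflexive (sym (+-identityʳ k))
  distGo-bound u v (suc f) k with reach adj k u v
  ... | true  = m≤m+n k (suc f)
  ... | false = subst (distGo adj u v f (suc k) ≤_) (sym (+-suc k f)) (distGo-bound u v f (suc k))

  dist-reaches : ∀ u v → Reach N u v → Reach (dist adj u v) u v
  dist-reaches u v = distGo-reaches N 0

  dist-least : ∀ j u v → Reach j u v → dist adj u v ≤ j
  dist-least j u v r = distGo-least N 0 r z≤n

  dist-bound : ∀ u v → dist adj u v ≤ N
  dist-bound u v = distGo-bound u v N 0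

module Distance {N : ℕ} (adj : Adj N) (adj-sym : ∀ u v → adj u v ≡ adj v u)
                (irrefl : ∀ u → adj u u ≡ false) (conn : ∀ u v → reach adj N u v ≡ true) where
  open Walks adj public

  reach-sym : ∀ k u v → Reach k u v → Reach k v u
  reach-sym zero u v e with reach-zero u v e
  ... | refl = reach-refl u
  reach-sym (suc k) u v e with reach-split k u v e
  ... | inj₁ short = reach-suc k v u (reach-sym k u v short)
  ... | inj₂ (w , ew , wv) =
    reach-trans 1 k v w u (reach-step 0 v v w (reach-refl v) (trans (adj-sym v w) wv)) (reach-sym k u w ew)

  δ : Fin N → Fin N → ℕ
  δ = dist adj

  δ-reaches : ∀ u v → Reach (δ u v) u v
  δ-reaches u v = dist-reaches u v (conn u v)

  δ-refl : ∀ u → δ u u ≡ 0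
  δ-refl u = n≤0⇒n≡0 (dist-least 0 u u (reach-refl u))

  δ≡0 : ∀ u v → δ u v ≡ 0 → u ≡ v
  δ≡0 u v e = reach-zero u v (subst (λ j → Reach j u v) e (δ-reaches u v))

  δ-sym : ∀ u v → δ u v ≡ δ v u
  δ-sym u v = ≤-antisym (dist-least (δ v u) u v (reach-sym (δ v u) v u (δ-reaches v u)))
                        (dist-least (δ u v) v u (reach-sym (δ u v) u v (δ-reaches u v)))

  δ-triangle : ∀ u w v → δ u v ≤ δ u w + δ w v
  δ-triangle u w v = dist-least _ u v (reach-trans (δ u w) (δ w v) u w v (δ-reaches u w) (δ-reaches w v))

  adj⇒≢ : ∀ u v → adj u v ≡ true → u ≢ v
  adj⇒≢ u .u uu refl = false≢true (trans (sym (irrefl u)) uu)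

  δ-positive : ∀ u v → u ≢ v → 1 ≤ δ u v
  δ-positive u v u≢v with δ u v in e
  ... | zero  = ⊥-elim (u≢v (δ≡0 u v e))
  ... | suc _ = s≤s z≤n

  adj⇒δ≡1 : ∀ u v → adj u v ≡ true → δ u v ≡ 1
  adj⇒δ≡1 u v a = ≤-antisym (dist-least 1 u v (reach-step 0 u u v (reach-refl u) a)) (δ-positive u v (adj⇒≢ u v a))

  δ≡1⇒adj : ∀ u v → δ u v ≡ 1 → adj u v ≡ true
  δ≡1⇒adj u v e with reach-split 0 u v (subst (λ j → Reach j u v) e (δ-reaches u v))
  ... | inj₁ r with reach-zero u v r
  ...   | refl = ⊥-elim (1+n≢0 (trans (sym e) (δ-refl u)))
  δ≡1⇒adj u v e | inj₂ (w , uw , wv) with reach-zero u w uw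
  ...   | refl = wv

  δ-neighbour : ∀ r u v → adj u v ≡ true → δ r v ≤ suc (δ r u)
  δ-neighbour r u v a = ≤-trans (δ-triangle r u v) (≤-reflexive (trans (cong (δ r u +_) (adj⇒δ≡1 u v a)) (+-comm _ 1)))

  δ-descent : ∀ r v k → δ r v ≡ suc k → Σ (Fin N) λ p → adj v p ≡ true × δ r p ≡ k
  δ-descent r v k e with reach-split k r v (subst (λ j → Reach j r v) e (δ-reaches r v))
  ... | inj₁ short = ⊥-elim (1+n≰n (subst (_≤ k) e (dist-least k r v short)))
  ... | inj₂ (p , rp , pv) = p , trans (adj-sym v p) pv ,
        ≤-antisym (dist-least k r p rp) (≤-pred (subst (_≤ suc (δ r p)) e (δ-neighbour r p v pv)))

  step-towards : ∀ D x → 0 < δ D x → Σ (Fin N) λ w → adj x w ≡ true × δ D w < δ D x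
  step-towards D x 0<δ = descend (δ D x) refl 0<δ
    where
    descend : ∀ j → δ D x ≡ j → 0 < j → Σ (Fin N) λ w → adj x w ≡ true × δ D w < δ D x
    descend (suc k) δ≡ _ with δ-descent D x k δ≡
    ... | w , xw , δw≡k = w , xw , subst₂ _<_ (sym δw≡k) (sym δ≡) ≤-refl

ind< : ℕ → ℕ → ℕ
ind< zero    zero    = 0
ind< zero    (suc y) = 1
ind< (suc x) zero    = 0
ind< (suc x) (suc y) = ind< x y

ind≡ : ℕ → ℕ → ℕ
ind≡ zero    zero    = 1
ind≡ zero    (suc y) = 0
ind≡ (suc x) zero    = 0
ind≡ (suc x) (suc y) = ind≡ x y

ind-trichotomy : ∀ x y → ind< x y + ind≡ x y + ind< y x ≡ 1
ind-trichotomy zero    zero    = refl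
ind-trichotomy zero    (suc y) = refl
ind-trichotomy (suc x) zero    = refl
ind-trichotomy (suc x) (suc y) = ind-trichotomy x y

ind<-sound : ∀ x y → 1 ≤ ind< x y → x < y
ind<-sound zero    (suc y) _ = s≤s z≤n
ind<-sound (suc x) (suc y) p = s≤s (ind<-sound x y p)

ind<-complete : ∀ x y → x < y → ind< x y ≡ 1
ind<-complete zero    (suc y) _         = refl
ind<-complete (suc x) (suc y) (s≤s x<y) = ind<-complete x y x<y

ind≡-refl : ∀ x → ind≡ x x ≡ 1
ind≡-refl zero    = refl
ind≡-refl (suc x) = ind≡-refl x

balance : ∀ a b c → b + (a + a) ≡ c + c → c ≤ a → b ≡ 0 × a ≡ c
balance a b c e c≤a = b≡0 , ≤-antisym a≤c c≤a
  where
  b≡0 : b ≡ 0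
  b≡0 = n≤0⇒n≡0 (+-cancelʳ-≤ (a + a) b 0 (≤-trans (≤-reflexive e) (+-mono-≤ c≤a c≤a)))
  a≤c : a ≤ c
  a≤c = +-cancelʳ-≤ a a c (begin
    a + a     ≡⟨ trans (sym (cong (_+ (a + a)) b≡0)) e ⟩
    c + c     ≤⟨ +-monoʳ-≤ c c≤a ⟩
    c + a     ∎)
    where open ≤-Reasoning

-- Seen from a root r, counting edges
-- shows that every vertex v ≠ r has exactly one neighbour closer to r, and
-- that no edge joins two vertices at the same distance from r.
module TreeLevels {N : ℕ} (adj : Adj N) (adj-sym : ∀ u v → adj u v ≡ adj v u)
                  (irrefl : ∀ u → adj u u ≡ false) (conn : ∀ u v → reach adj N u v ≡ true)
                  (edges : degSum adj ≡ 2 * (N ∸ 1)) where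
  open Distance adj adj-sym irrefl conn public

  edge : Fin N → Fin N → ℕ
  edge v w = if adj v w then 1 else 0

  edge-term : ∀ v w k → adj v w ≡ true → edge v w * k ≡ k
  edge-term v w k a rewrite a = +-identityʳ k

  module Rooted (r : Fin N) where

    ℓ : Fin N → ℕ
    ℓ = δ r

    lower level upper : Fin N → ℕ
    lower v = ∑[ w < N ] (edge v w * ind< (ℓ w) (ℓ v))
    level v = ∑[ w < N ] (edge v w * ind≡ (ℓ w) (ℓ v))
    upper v = ∑[ w < N ] (edge v w * ind< (ℓ v) (ℓ w))

    deg-split : ∀ v → deg adj v ≡ lower v + level v + upper v
    deg-split v = begin
      deg adj v
        ≡⟨ sum-allFin N (edge v) ⟩
      ∑[ w < N ] edge v w
        ≡⟨ sum-cong-≗ (λ w → split (edge v w) (ℓ w) (ℓ v)) ⟩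
      ∑[ w < N ] (edge v w * ind< (ℓ w) (ℓ v) + edge v w * ind≡ (ℓ w) (ℓ v) + edge v w * ind< (ℓ v) (ℓ w))
        ≡⟨ ∑-distrib-+ (λ w → edge v w * ind< (ℓ w) (ℓ v) + edge v w * ind≡ (ℓ w) (ℓ v))
                       (λ w → edge v w * ind< (ℓ v) (ℓ w)) ⟩
      ∑[ w < N ] (edge v w * ind< (ℓ w) (ℓ v) + edge v w * ind≡ (ℓ w) (ℓ v)) + upper v
        ≡⟨ cong (_+ upper v) (∑-distrib-+ (λ w → edge v w * ind< (ℓ w) (ℓ v))
                                           (λ w → edge v w * ind≡ (ℓ w) (ℓ v))) ⟩
      lower v + level v + upper v ∎
      where
      open ≡-Reasoning
      split : ∀ e x y → e ≡ e * ind< x y + e * ind≡ x y + e * ind< y x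
      split e x y = begin
        e                                          ≡⟨ sym (*-identityʳ e) ⟩
        e * 1                                      ≡⟨ cong (e *_) (sym (ind-trichotomy x y)) ⟩
        e * (ind< x y + ind≡ x y + ind< y x)       ≡⟨ *-distribˡ-+ e (ind< x y + ind≡ x y) _ ⟩
        e * (ind< x y + ind≡ x y) + e * ind< y x   ≡⟨ cong (_+ e * ind< y x) (*-distribˡ-+ e _ _) ⟩
        e * ind< x y + e * ind≡ x y + e * ind< y x ∎

    -- Every edge between different levels is counted once from each end.
    ∑lower≡∑upper : ∑ lower ≡ ∑ upper
    ∑lower≡∑upper = trans (∑-comm (λ v w → edge v w * ind< (ℓ w) (ℓ v)))
      (sum-cong-≗ λ w → sum-cong-≗ λ v → cong (λ b → (if b then 1 else 0) * ind< (ℓ w) (ℓ v)) (adj-sym v w))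

    others≤lower : ∀ v → others r v ≤ lower v
    others≤lower v with v ≟ r
    ... | yes _   = z≤n
    ... | no v≢r = has-lower (ℓ v) refl
      where
      has-lower : ∀ j → ℓ v ≡ j → 1 ≤ lower v
      has-lower zero    ℓv≡0 = ⊥-elim (v≢r (sym (δ≡0 r v ℓv≡0)))
      has-lower (suc k) ℓv≡ with δ-descent r v k ℓv≡
      ... | p , vp , ℓp≡ = ≤-trans (≤-reflexive (sym counted)) (term≤∑ (λ w → edge v w * ind< (ℓ w) (ℓ v)) p)
        where
        counted : edge v p * ind< (ℓ p) (ℓ v) ≡ 1
        counted = trans (edge-term v p _ vp) (ind<-complete (ℓ p) (ℓ v) (subst₂ _<_ (sym ℓp≡) (sym ℓv≡) ≤-refl))

    handshake : ∑ level + (∑ lower + ∑ lower) ≡ (N ∸ 1) + (N ∸ 1)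
    handshake = begin
      ∑ level + (∑ lower + ∑ lower)   ≡⟨ cong (λ x → ∑ level + (∑ lower + x)) ∑lower≡∑upper ⟩
      ∑ level + (∑ lower + ∑ upper)   ≡⟨ rearrange (∑ lower) (∑ level) (∑ upper) ⟩
      ∑ lower + ∑ level + ∑ upper     ≡⟨ cong (_+ ∑ upper) (sym (∑-distrib-+ lower level)) ⟩
      ∑ (λ v → lower v + level v) + ∑ upper ≡⟨ sym (∑-distrib-+ (λ v → lower v + level v) upper) ⟩
      ∑ (λ v → lower v + level v + upper v) ≡⟨ sym (sum-cong-≗ deg-split) ⟩
      ∑ (deg adj)                     ≡⟨ sym (sum-allFin N (deg adj)) ⟩
      degSum adj                      ≡⟨ edges ⟩
      2 * (N ∸ 1)                     ≡⟨ cong (N ∸ 1 +_) (+-identityʳ (N ∸ 1)) ⟩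
      (N ∸ 1) + (N ∸ 1)               ∎
      where
      open ≡-Reasoning
      rearrange : ∀ a b c → b + (a + c) ≡ a + b + c
      rearrange a b c = trans (sym (+-assoc b a c)) (cong (_+ c) (+-comm b a))

    private
      counts : ∑ level ≡ 0 × ∑ lower ≡ ∑ (others r)
      counts = balance (∑ lower) (∑ level) (∑ (others r))
        (trans handshake (sym (cong₂ _+_ (∑-others N r) (∑-others N r))))
        (∑-mono (others r) lower others≤lower)

    level≡0 : ∀ v → level v ≡ 0
    level≡0 = ∑-tight (λ _ → 0) level (λ _ → z≤n) (≤-reflexive (trans (proj₁ counts) (sym (sum-replicate-zero N))))

    lower≡others : ∀ v → lower v ≡ others r v
    lower≡others = ∑-tight (others r) lower others≤lower (≤-reflexive (proj₂ counts))

    level-changes : ∀ v w → adj v w ≡ true → ℓ w ≢ ℓ v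
    level-changes v w a ℓw≡ℓv = 1+n≰n (begin
      1                                  ≡⟨ sym counted ⟩
      edge v w * ind≡ (ℓ w) (ℓ v)        ≤⟨ term≤∑ (λ w → edge v w * ind≡ (ℓ w) (ℓ v)) w ⟩
      level v                            ≡⟨ level≡0 v ⟩
      0                                  ∎)
      where
      open ≤-Reasoning
      counted : edge v w * ind≡ (ℓ w) (ℓ v) ≡ 1
      counted rewrite ℓw≡ℓv = trans (edge-term v w _ a) (ind≡-refl (ℓ v))

    closer⇒step : ∀ v w → adj v w ≡ true → ℓ w < ℓ v → ℓ v ≡ suc (ℓ w)
    closer⇒step v w a ℓw<ℓv = ≤-antisym (δ-neighbour r w v (trans (adj-sym w v) a)) ℓw<ℓv

    not-closer⇒step : ∀ v w → adj v w ≡ true → ¬ (ℓ w < ℓ v) → ℓ w ≡ suc (ℓ v)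
    not-closer⇒step v w a ℓw≮ℓv =
      ≤-antisym (δ-neighbour r v w a) (≤∧≢⇒< (≮⇒≥ ℓw≮ℓv) (level-changes v w a ∘ sym))

    parent-unique : ∀ v w₁ w₂ → v ≢ r → adj v w₁ ≡ true → adj v w₂ ≡ true →
                    ℓ w₁ < ℓ v → ℓ w₂ < ℓ v → w₁ ≡ w₂
    parent-unique v w₁ w₂ v≢r a₁ a₂ l₁ l₂ with w₁ ≟ w₂
    ... | yes w₁≡w₂ = w₁≡w₂
    ... | no  w₁≢w₂ = ⊥-elim (1+n≰n (begin
      2                       ≡⟨ sym (cong₂ _+_ (counted w₁ a₁ l₁) (counted w₂ a₂ l₂)) ⟩
      term w₁ + term w₂       ≤⟨ two-terms≤∑ term w₁ w₂ w₁≢w₂ ⟩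
      lower v                 ≡⟨ lower≡others v ⟩
      others r v              ≡⟨ others-≢ r v v≢r ⟩
      1                       ∎))
      where
      open ≤-Reasoning
      term : Fin N → ℕ
      term w = edge v w * ind< (ℓ w) (ℓ v)
      counted : ∀ w → adj v w ≡ true → ℓ w < ℓ v → term w ≡ 1
      counted w a l = trans (edge-term v w _ a) (ind<-complete (ℓ w) (ℓ v) l)

    upper-count : ∀ v → v ≢ r → deg adj v ≡ 1 + upper v
    upper-count v v≢r = begin
      deg adj v                      ≡⟨ deg-split v ⟩
      lower v + level v + upper v    ≡⟨ cong₂ (λ a b → a + b + upper v)
                                          (trans (lower≡others v) (others-≢ r v v≢r)) (level≡0 v) ⟩
      1 + 0 + upper v                ∎
      where open ≡-Reasoning

    has-child : ∀ v → v ≢ r → 2 ≤ deg adj v → Σ (Fin N) λ w → adj v w ≡ true × ℓ v < ℓ w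
    has-child v v≢r 2≤deg = child (∑-positive (λ w → edge v w * ind< (ℓ v) (ℓ w)) 1≤upper)
      where
      1≤upper : 1 ≤ upper v
      1≤upper = +-cancelˡ-≤ 1 1 (upper v) (subst (2 ≤_) (upper-count v v≢r) 2≤deg)
      child : (Σ (Fin N) λ w → 1 ≤ edge v w * ind< (ℓ v) (ℓ w)) → Σ (Fin N) λ w → adj v w ≡ true × ℓ v < ℓ w
      child (w , 1≤term) with adj v w in vw
      ... | true = w , vw , ind<-sound (ℓ v) (ℓ w) (subst (1 ≤_) (+-identityʳ _) 1≤term)

  -- If x has two different neighbours, y₁ closer to D and y₂ closer to E,
  -- then the geodesic from D to E passes through x.  Induction on δ E y₂,
  -- moving x one step towards E.
  through-vertex : ∀ k D E x y₁ y₂ → adj x y₁ ≡ true → adj x y₂ ≡ true → y₁ ≢ y₂ →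
                   δ D y₁ < δ D x → δ E y₂ < δ E x → δ E y₂ ≡ k → δ D E ≡ δ D x + δ E x
  through-vertex k D E x y₁ y₂ xy₁ xy₂ y₁≢y₂ D-closer E-closer Ey₂≡k = via-y₂ k Ey₂≡k
    where
    x≢D : x ≢ D
    x≢D refl = <⇒≱ D-closer (≤-trans (≤-reflexive (δ-refl D)) z≤n)
    Dy₂ : δ D y₂ ≡ suc (δ D x)
    Dy₂ = Rooted.not-closer⇒step D x y₂ xy₂
            (λ y₂-closer → y₁≢y₂ (Rooted.parent-unique D x y₁ y₂ x≢D xy₁ xy₂ D-closer y₂-closer))
    Ex : δ E x ≡ suc (δ E y₂)
    Ex = Rooted.closer⇒step E x y₂ xy₂ E-closer
    via-y₂ : ∀ j → δ E y₂ ≡ j → δ D E ≡ δ D x + δ E x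
    via-y₂ zero Ey₂≡0 with δ≡0 E y₂ Ey₂≡0
    ... | refl = begin
      δ D E                  ≡⟨ Dy₂ ⟩
      suc (δ D x)            ≡⟨ cong suc (sym (+-identityʳ (δ D x))) ⟩
      suc (δ D x + 0)        ≡⟨ sym (+-suc (δ D x) 0) ⟩
      δ D x + 1              ≡⟨ cong (λ d → δ D x + suc d) (sym Ey₂≡0) ⟩
      δ D x + suc (δ E E)    ≡⟨ cong (δ D x +_) (sym Ex) ⟩
      δ D x + δ E x          ∎
      where open ≡-Reasoning
    via-y₂ (suc j) Ey₂≡ with δ-descent E y₂ j Ey₂≡
    ... | z , y₂z , Ez≡j = begin
      δ D E                  ≡⟨ through-vertex j D E y₂ x z (trans (adj-sym y₂ x) xy₂) y₂z x≢z
                                  (≤-reflexive (sym Dy₂)) z-closer Ez≡j ⟩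
      δ D y₂ + δ E y₂        ≡⟨ cong (_+ δ E y₂) Dy₂ ⟩
      suc (δ D x) + δ E y₂   ≡⟨ sym (+-suc (δ D x) (δ E y₂)) ⟩
      δ D x + suc (δ E y₂)   ≡⟨ cong (δ D x +_) (sym Ex) ⟩
      δ D x + δ E x          ∎
      where
      open ≡-Reasoning
      z-closer : δ E z < δ E y₂
      z-closer = ≤-reflexive (trans (cong suc Ez≡j) (sym Ey₂≡))
      x≢z : x ≢ z
      x≢z refl = <⇒≱ E-closer (<⇒≤ z-closer)

  same-side : ∀ D E x y → adj x y ≡ true → δ D y < δ D x → δ E y < δ E x → δ D E < δ D x + δ E x
  same-side D E x y xy D-closer E-closer = begin-strict
    δ D E            ≤⟨ δ-triangle D y E ⟩
    δ D y + δ y E    ≡⟨ cong (δ D y +_) (δ-sym y E) ⟩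
    δ D y + δ E y    <⟨ +-mono-<-≤ D-closer (<⇒≤ E-closer) ⟩
    δ D x + δ E x    ∎
    where open ≤-Reasoning

  opposite-sides : ∀ D E x y → adj x y ≡ true → δ D y < δ D x → ¬ (δ E y < δ E x) → δ D E ≡ δ D x + δ E x
  opposite-sides D E x y xy D-closer E-not-closer = towards-E (δ E x) refl
    where
    towards-E : ∀ j → δ E x ≡ j → δ D E ≡ δ D x + δ E x
    towards-E zero Ex≡0 with δ≡0 E x Ex≡0
    ... | refl = sym (trans (cong (δ D E +_) (δ-refl E)) (+-identityʳ (δ D E)))
    towards-E (suc k) Ex≡ with δ-descent E x k Ex≡
    ... | z , xz , Ez≡k = through-vertex (δ E z) D E x y z xy xz y≢z D-closer z-closer refl
      where
      z-closer : δ E z < δ E x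
      z-closer = ≤-reflexive (trans (cong suc Ez≡k) (sym Ex≡))
      y≢z : y ≢ z
      y≢z refl = E-not-closer z-closer

  -- Leaf-free test for the side of an edge: when y is the neighbour of x
  -- towards D, a vertex E lies on y's side iff the geodesic D–E avoids x.
  side-test : ∀ D E x y → adj x y ≡ true → δ D y < δ D x →
              (δ E y < δ E x) ⇔ (δ D E < δ D x + δ E x)
  side-test D E x y xy D-closer = mk⇔ (same-side D E x y xy D-closer) avoids⇒closer
    where
    avoids⇒closer : δ D E < δ D x + δ E x → δ E y < δ E x
    avoids⇒closer shortcut with δ E y <? δ E x
    ... | yes closer     = closer
    ... | no  not-closer = ⊥-elim (<-irrefl (opposite-sides D E x y xy D-closer not-closer) shortcut)

Step : ℕ → ℕ → Set
Step a b = a ≡ suc b ⊎ b ≡ suc a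

-- Every vertex
-- lies on a path between leaves; consequently a vertex is determined by its
-- leaf-distance profile, edges are the pairs whose profiles differ by one at
-- every leaf, and distances between leaves reveal on which side of an edge a
-- leaf lies.
module LeafGeometry {n : ℕ} (T : UBTree n) where
  open UBTree T using (m; adj)
  open TreeLevels adj (UBTree.sym T) (UBTree.irrefl T) (UBTree.conn T) (UBTree.edges T) public

  N : ℕ
  N = n + m

  leaf : Fin n → Fin N
  leaf A = A ↑ˡ m

  vertex-kind : ∀ v → (Σ (Fin n) λ A → leaf A ≡ v) ⊎ (Σ (Fin m) λ i → n ↑ʳ i ≡ v)
  vertex-kind v with splitAt n v in e
  ... | inj₁ A = inj₁ (A , splitAt⁻¹-↑ˡ e)
  ... | inj₂ i = inj₂ (i , splitAt⁻¹-↑ʳ e)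

  profile : Fin N → Fin n → ℕ
  profile v A = δ (leaf A) v

  -- Walking away from u through v one always reaches a leaf A such that v lies
  -- on the geodesic from u to A: internal vertices have a child, and the walk
  -- cannot go on for more than N steps.
  leaf-beyond : ∀ u v → u ≢ v → Σ (Fin n) λ A → δ u v + profile v A ≤ profile u A
  leaf-beyond u v u≢v = walk-away N v u≢v (m≤m+n N (δ u v))
    where
    open Rooted u
    extend : ∀ v q A → adj v q ≡ true → δ u v < δ u q → δ u q + profile q A ≤ profile u A →
             δ u v + profile v A ≤ profile u A
    extend v q A vq v<q q-on-path = begin
      δ u v + profile v A                 ≤⟨ +-monoʳ-≤ (δ u v) (δ-triangle (leaf A) q v) ⟩
      δ u v + (profile q A + δ q v)       ≡⟨ cong (λ d → δ u v + (profile q A + d))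
                                                 (trans (δ-sym q v) (adj⇒δ≡1 v q vq)) ⟩
      δ u v + (profile q A + 1)           ≡⟨ cong (δ u v +_) (+-comm (profile q A) 1) ⟩
      δ u v + suc (profile q A)           ≡⟨ +-suc (δ u v) (profile q A) ⟩
      suc (δ u v) + profile q A           ≤⟨ +-monoˡ-≤ (profile q A) v<q ⟩
      δ u q + profile q A                 ≤⟨ q-on-path ⟩
      profile u A                         ∎
      where open ≤-Reasoning
    walk-away : ∀ f v → u ≢ v → N ≤ f + δ u v → Σ (Fin n) λ A → δ u v + profile v A ≤ profile u A
    walk-away f v u≢v fuel with vertex-kind v
    ... | inj₁ (A , refl) = A , ≤-reflexive (trans (cong (δ u (leaf A) +_) (δ-refl (leaf A)))
                                                   (trans (+-identityʳ _) (δ-sym u (leaf A))))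
    ... | inj₂ (i , refl) with has-child v (u≢v ∘ sym) (≤-trans (n≤1+n 2) (≤-reflexive (sym (UBTree.internalDeg T i))))
    ...   | q , vq , v<q with f
    ...     | zero  = ⊥-elim (<⇒≱ v<q (≤-trans (dist-bound u q) fuel))
    ...     | suc f with walk-away f q (λ { refl → <⇒≱ v<q (≤-trans (≤-reflexive (δ-refl u)) z≤n) })
                                     (≤-trans fuel (≤-trans (≤-reflexive (sym (+-suc f (δ u v)))) (+-monoʳ-≤ f v<q)))
    ...       | A , q-on-path = A , extend v q A vq v<q q-on-path

  -- Distinct vertices have distinct profiles: a leaf beyond v as seen from u
  -- is strictly farther from u than from v.
  profile-injective : ∀ u v → (∀ A → profile u A ≡ profile v A) → u ≡ v
  profile-injective u v same with u ≟ v
  ... | yes u≡v = u≡v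
  ... | no  u≢v with leaf-beyond u v u≢v
  ...   | A , v-on-path = ⊥-elim (1+n≰n (begin
    suc (profile v A)            ≤⟨ +-monoˡ-≤ (profile v A) (δ-positive u v u≢v) ⟩
    δ u v + profile v A          ≤⟨ v-on-path ⟩
    profile u A                  ≡⟨ same A ⟩
    profile v A                  ∎))
    where open ≤-Reasoning

  adj⇒steps : ∀ u v → adj u v ≡ true → ∀ A → Step (profile u A) (profile v A)
  adj⇒steps u v a A with profile v A <? profile u A
  ... | yes v-closer = inj₁ (Rooted.closer⇒step (leaf A) u v a v-closer)
  ... | no  v-farther = inj₂ (Rooted.not-closer⇒step (leaf A) u v a v-farther)

  steps⇒adj : Fin n → ∀ u v → (∀ A → Step (profile u A) (profile v A)) → adj u v ≡ true
  steps⇒adj L u v steps with u ≟ v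
  ... | yes refl = ⊥-elim (no-self-step (steps L))
    where
    no-self-step : ∀ {x} → ¬ Step x x
    no-self-step (inj₁ e) = 1+n≢n (sym e)
    no-self-step (inj₂ e) = 1+n≢n (sym e)
  ... | no u≢v with leaf-beyond u v u≢v
  ...   | A , v-on-path = δ≡1⇒adj u v (≤-antisym δuv≤1 (δ-positive u v u≢v))
    where
    u-within-one : profile u A ≤ suc (profile v A)
    u-within-one with steps A
    ... | inj₁ e = ≤-reflexive e
    ... | inj₂ e = ≤-trans (n≤1+n _) (≤-trans (≤-reflexive (sym e)) (n≤1+n _))
    δuv≤1 : δ u v ≤ 1
    δuv≤1 = +-cancelʳ-≤ (profile v A) (δ u v) 1 (≤-trans v-on-path u-within-one)

  leaf-behind : ∀ x v → adj x v ≡ true → Σ (Fin n) λ A → profile v A < profile x A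
  leaf-behind x v xv with leaf-beyond x v (adj⇒≢ x v xv)
  ... | A , v-on-path = A , (begin-strict
    profile v A             <⟨ n<1+n (profile v A) ⟩
    suc (profile v A)       ≡⟨ cong (_+ profile v A) (sym (adj⇒δ≡1 x v xv)) ⟩
    δ x v + profile v A     ≤⟨ v-on-path ⟩
    profile x A             ∎)
    where open ≤-Reasoning

-- Fixing a leaf L, every
-- vertex v of T₁ has a vertex of T₂ with the same leaf-distance profile, by
-- induction on the distance from L: if x is the parent of v and x′ matches x,
-- pick a leaf A behind the edge x–v and let w be the neighbour of x′ towards A;
-- by the side test, which only involves leaf distances, every leaf lies on
-- v's side of x–v iff it lies on w's side of x′–w, so w matches v.
module ProfileMatch {n : ℕ} (T₁ T₂ : UBTree n) (same-ε : ∀ A B → ε T₁ A B ≡ ε T₂ A B) (L : Fin n) where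
  module G₁ = LeafGeometry T₁
  module G₂ = LeafGeometry T₂

  Matches : Fin G₁.N → Fin G₂.N → Set
  Matches v w = ∀ E → G₁.profile v E ≡ G₂.profile w E

  match-edge : ∀ x v x′ w → UBTree.adj T₁ x v ≡ true → UBTree.adj T₂ x′ w ≡ true → Matches x x′ →
               ∀ A → G₁.profile v A < G₁.profile x A → G₂.profile w A < G₂.profile x′ A → Matches v w
  match-edge x v x′ w xv x′w x≈x′ A v-closer w-closer E = by-side (G₁.profile v E <? G₁.profile x E)
    where
    open ≡-Reasoning
    shortcut₁⇔shortcut₂ : (G₁.δ (G₁.leaf A) (G₁.leaf E) < G₁.profile x A + G₁.profile x E) ⇔
                          (G₂.δ (G₂.leaf A) (G₂.leaf E) < G₂.profile x′ A + G₂.profile x′ E)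
    shortcut₁⇔shortcut₂ = mk⇔ (subst₂ _<_ (same-ε A E) sums) (subst₂ _<_ (sym (same-ε A E)) (sym sums))
      where
      sums : G₁.profile x A + G₁.profile x E ≡ G₂.profile x′ A + G₂.profile x′ E
      sums = cong₂ _+_ (x≈x′ A) (x≈x′ E)
    sides : (G₁.profile v E < G₁.profile x E) ⇔ (G₂.profile w E < G₂.profile x′ E)
    sides = ⇔-trans (G₁.side-test (G₁.leaf A) (G₁.leaf E) x v xv v-closer)
              (⇔-trans shortcut₁⇔shortcut₂ (⇔-sym (G₂.side-test (G₂.leaf A) (G₂.leaf E) x′ w x′w w-closer)))
    by-side : Dec (G₁.profile v E < G₁.profile x E) → G₁.profile v E ≡ G₂.profile w E
    by-side (yes closer₁) = suc-injective (begin
      suc (G₁.profile v E)   ≡⟨ sym (G₁.Rooted.closer⇒step (G₁.leaf E) x v xv closer₁) ⟩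
      G₁.profile x E         ≡⟨ x≈x′ E ⟩
      G₂.profile x′ E        ≡⟨ G₂.Rooted.closer⇒step (G₂.leaf E) x′ w x′w (Equivalence.to sides closer₁) ⟩
      suc (G₂.profile w E)   ∎)
    by-side (no farther₁) = begin
      G₁.profile v E         ≡⟨ G₁.Rooted.not-closer⇒step (G₁.leaf E) x v xv farther₁ ⟩
      suc (G₁.profile x E)   ≡⟨ cong suc (x≈x′ E) ⟩
      suc (G₂.profile x′ E)  ≡⟨ sym (G₂.Rooted.not-closer⇒step (G₂.leaf E) x′ w x′w
                                    (farther₁ ∘ Equivalence.from sides)) ⟩
      G₂.profile w E         ∎

  match-neighbour : ∀ x v → UBTree.adj T₁ x v ≡ true → Σ (Fin G₂.N) (Matches x) → Σ (Fin G₂.N) (Matches v)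
  match-neighbour x v xv (x′ , x≈x′) with G₁.leaf-behind x v xv
  ... | A , v-closer with G₂.step-towards (G₂.leaf A) x′ (subst (0 <_) (x≈x′ A) (≤-<-trans z≤n v-closer))
  ...   | w , x′w , w-closer = w , match-edge x v x′ w xv x′w x≈x′ A v-closer w-closer

  match : ∀ k v → G₁.δ (G₁.leaf L) v ≡ k → Σ (Fin G₂.N) (Matches v)
  match zero v Lv≡0 with G₁.δ≡0 (G₁.leaf L) v Lv≡0
  ... | refl = G₂.leaf L , λ E → same-ε E L
  match (suc k) v Lv≡ with G₁.δ-descent (G₁.leaf L) v k Lv≡
  ... | x , vx , Lx≡k = match-neighbour x v (trans (UBTree.sym T₁ x v) vx) (match k x Lx≡k)

  matching : Fin G₁.N → Fin G₂.N
  matching v = proj₁ (match _ v refl)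

  matching-matches : ∀ v → Matches v (matching v)
  matching-matches v = proj₂ (match _ v refl)

-- Trees with the same leaf-to-leaf distances are isomorphic (given a leaf):
-- the matchings in both directions are mutually inverse because profiles are
-- injective, they fix the leaves, and they preserve edges because edges are
-- characterised by profiles.
same-ε⇒≅ : ∀ {n} (T₁ T₂ : UBTree n) → Fin n → (∀ A B → ε T₁ A B ≡ ε T₂ A B) → T₁ ≅ T₂
same-ε⇒≅ T₁ T₂ L same-ε = mk↔ₛ′ to from to∘from from∘to , to-leaf , to-adj
  where
  module G₁ = LeafGeometry T₁
  module G₂ = LeafGeometry T₂
  open ProfileMatch T₁ T₂ same-ε L using () renaming (matching to to; matching-matches to to-matches)
  open ProfileMatch T₂ T₁ (λ A B → sym (same-ε A B)) L using () renaming (matching to from; matching-matches to from-matches)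

  to∘from : ∀ w → to (from w) ≡ w
  to∘from w = G₂.profile-injective _ _ λ E → trans (sym (to-matches (from w) E)) (sym (from-matches w E))

  from∘to : ∀ v → from (to v) ≡ v
  from∘to v = G₁.profile-injective _ _ λ E → trans (sym (from-matches (to v) E)) (sym (to-matches v E))

  to-leaf : ∀ A → to (G₁.leaf A) ≡ G₂.leaf A
  to-leaf A = G₂.profile-injective _ _ λ E → trans (sym (to-matches (G₁.leaf A) E)) (same-ε E A)

  to-adj : ∀ u v → UBTree.adj T₂ (to u) (to v) ≡ UBTree.adj T₁ u v
  to-adj u v = true-iff⇒≡
    (λ e → G₁.steps⇒adj L u v λ A → subst₂ Step (sym (to-matches u A)) (sym (to-matches v A)) (G₂.adj⇒steps _ _ e A))
    (λ e → G₂.steps⇒adj L (to u) (to v) λ A → subst₂ Step (to-matches u A) (to-matches v A) (G₁.adj⇒steps u v e A))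

module Transport {N₁ N₂ : ℕ} (adj₁ : Adj N₁) (adj₂ : Adj N₂) (φ : Fin N₁ ↔ Fin N₂)
                 (φ-adj : ∀ u v → adj₂ (Inverse.to φ u) (Inverse.to φ v) ≡ adj₁ u v) where
  open Inverse φ using (to; from)
  module W₁ = Walks adj₁
  module W₂ = Walks adj₂

  to∘from : ∀ w → to (from w) ≡ w
  to∘from w = Inverse.inverseˡ φ refl

  from∘to : ∀ v → from (to v) ≡ v
  from∘to v = Inverse.inverseʳ φ refl

  reach-preserved : ∀ k u v → reach adj₂ k (to u) (to v) ≡ reach adj₁ k u v
  reach-preserved zero u v = true-iff⇒≡
    (λ e → subst (W₁.Reach 0 u) (to-injective (W₂.reach-zero (to u) (to v) e)) (W₁.reach-refl u))
    (λ e → subst (λ z → W₂.Reach 0 (to u) (to z)) (W₁.reach-zero u v e) (W₂.reach-refl (to u)))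
    where
    to-injective : to u ≡ to v → u ≡ v
    to-injective e = trans (sym (from∘to u)) (trans (cong from e) (from∘to v))
  reach-preserved (suc k) u v = true-iff⇒≡ backward forward
    where
    forward : W₁.Reach (suc k) u v → W₂.Reach (suc k) (to u) (to v)
    forward e with W₁.reach-split k u v e
    ... | inj₁ short = W₂.reach-suc k (to u) (to v) (trans (reach-preserved k u v) short)
    ... | inj₂ (w , uw , wv) = W₂.reach-step k (to u) (to w) (to v) (trans (reach-preserved k u w) uw) (trans (φ-adj w v) wv)
    backward : W₂.Reach (suc k) (to u) (to v) → W₁.Reach (suc k) u v
    backward e with W₂.reach-split k (to u) (to v) e
    ... | inj₁ short = W₁.reach-suc k u v (trans (sym (reach-preserved k u v)) short)
    ... | inj₂ (w′ , uw′ , w′v) = W₁.reach-step k u (from w′) v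
          (trans (sym (reach-preserved k u (from w′))) (subst (λ z → W₂.Reach k (to u) z) (sym (to∘from w′)) uw′))
          (trans (sym (φ-adj (from w′) v)) (subst (λ z → adj₂ z (to v) ≡ true) (sym (to∘from w′)) w′v))

  dist-preserved : (∀ u v → reach adj₁ N₁ u v ≡ true) → (∀ u v → reach adj₂ N₂ u v ≡ true) →
                   ∀ u v → dist adj₂ (to u) (to v) ≡ dist adj₁ u v
  dist-preserved conn₁ conn₂ u v = ≤-antisym
    (W₂.dist-least (dist adj₁ u v) (to u) (to v)
      (trans (reach-preserved (dist adj₁ u v) u v) (W₁.dist-reaches u v (conn₁ u v))))
    (W₁.dist-least (dist adj₂ (to u) (to v)) u v
      (trans (sym (reach-preserved (dist adj₂ (to u) (to v)) u v)) (W₂.dist-reaches (to u) (to v) (conn₂ (to u) (to v)))))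

≅⇒same-ε : ∀ {n} (T₁ T₂ : UBTree n) → T₁ ≅ T₂ → ∀ A B → ε T₁ A B ≡ ε T₂ A B
≅⇒same-ε T₁ T₂ (φ , φ-leaf , φ-adj) A B = begin
  ε T₁ A B                                           ≡⟨ sym (dist-preserved (UBTree.conn T₁) (UBTree.conn T₂) _ _) ⟩
  dist (UBTree.adj T₂) (to (G₁.leaf A)) (to (G₁.leaf B)) ≡⟨ cong₂ (dist (UBTree.adj T₂)) (φ-leaf A) (φ-leaf B) ⟩
  ε T₂ A B                                           ∎
  where
  open ≡-Reasoning
  open Inverse φ using (to)
  open Transport (UBTree.adj T₁) (UBTree.adj T₂) φ φ-adj using (dist-preserved)
  module G₁ = LeafGeometry T₁

maxList-≥ : ∀ {A : Set} {N} (h : A → ℕ) (g : Fin N → A) i → h (g i) ≤ maxList (map h (tabulate g))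
maxList-≥ h g zero    = m≤m⊔n _ _
maxList-≥ h g (suc i) = ≤-trans (maxList-≥ h (g ∘ suc) i) (m≤n⊔m _ _)

maxList-lub : ∀ {A : Set} {N} (h : A → ℕ) (g : Fin N → A) c →
              (∀ i → h (g i) ≤ c) → maxList (map h (tabulate g)) ≤ c
maxList-lub {N = zero}  h g c bound = z≤n
maxList-lub {N = suc N} h g c bound = ⊔-lub (bound zero) (maxList-lub h (g ∘ suc) c (bound ∘ suc))

discrepancy≤d : ∀ {n} (T₁ T₂ : UBTree n) A B → ∣ ε T₁ A B - ε T₂ A B ∣ ≤ d T₁ T₂
discrepancy≤d {n} T₁ T₂ A B = ≤-trans (maxList-≥ (λ B → ∣ ε T₁ A B - ε T₂ A B ∣) id B)
  (maxList-≥ (λ A → maxList (map (λ B → ∣ ε T₁ A B - ε T₂ A B ∣) (allFin n))) id A)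

d-lub : ∀ {n} (T₁ T₂ : UBTree n) c → (∀ A B → ∣ ε T₁ A B - ε T₂ A B ∣ ≤ c) → d T₁ T₂ ≤ c
d-lub T₁ T₂ c bound = maxList-lub _ id c (λ A → maxList-lub _ id c (bound A))

d-cong : ∀ {n} (T₁ T₂ T₃ T₄ : UBTree n) →
         (∀ A B → ∣ ε T₁ A B - ε T₂ A B ∣ ≡ ∣ ε T₃ A B - ε T₄ A B ∣) → d T₁ T₂ ≡ d T₃ T₄
d-cong T₁ T₂ T₃ T₄ same = ≤-antisym
  (d-lub T₁ T₂ _ λ A B → ≤-trans (≤-reflexive (same A B)) (discrepancy≤d T₃ T₄ A B))
  (d-lub T₃ T₄ _ λ A B → ≤-trans (≤-reflexive (sym (same A B))) (discrepancy≤d T₁ T₂ A B))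

d-self : ∀ {n} (T : UBTree n) → d T T ≡ 0
d-self T = n≤0⇒n≡0 (d-lub T T 0 λ A B → ≤-reflexive (∣n-n∣≡0 (ε T A B)))

theorem1 : (n : ℕ) → 3 ≤ n →
    (∀ (T₁ T₁′ T₂ : UBTree n) → T₁ ≅ T₁′ → d T₁ T₂ ≡ d T₁′ T₂) ×
    (∀ (T₁ T₂ : UBTree n) → (d T₁ T₂ ≡ 0) ⇔ (T₁ ≅ T₂)) ×
    (∀ (T₁ T₂ : UBTree n) → d T₁ T₂ ≡ d T₂ T₁) ×
    (∀ (T₁ T₂ T₃ : UBTree n) → d T₁ T₃ ≤ d T₁ T₂ + d T₂ T₃)
theorem1 n 3≤n = iso-invariant , zero⇔iso , symmetric , triangle
  where
  -- The hypothesis n ≥ 3 is only needed to have some leaf.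
  some-leaf : Fin n
  some-leaf = fromℕ< (≤-trans (s≤s z≤n) 3≤n)

  iso-invariant : ∀ (T₁ T₁′ T₂ : UBTree n) → T₁ ≅ T₁′ → d T₁ T₂ ≡ d T₁′ T₂
  iso-invariant T₁ T₁′ T₂ iso =
    d-cong T₁ T₂ T₁′ T₂ λ A B → cong (λ e → ∣ e - ε T₂ A B ∣) (≅⇒same-ε T₁ T₁′ iso A B)

  zero⇔iso : ∀ (T₁ T₂ : UBTree n) → (d T₁ T₂ ≡ 0) ⇔ (T₁ ≅ T₂)
  zero⇔iso T₁ T₂ = mk⇔
    (λ d≡0 → same-ε⇒≅ T₁ T₂ some-leaf λ A B →
      ∣m-n∣≡0⇒m≡n (n≤0⇒n≡0 (≤-trans (discrepancy≤d T₁ T₂ A B) (≤-reflexive d≡0))))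
    (λ iso → trans (iso-invariant T₁ T₂ T₂ iso) (d-self T₂))

  symmetric : ∀ (T₁ T₂ : UBTree n) → d T₁ T₂ ≡ d T₂ T₁
  symmetric T₁ T₂ = d-cong T₁ T₂ T₂ T₁ λ A B → ∣-∣-comm (ε T₁ A B) (ε T₂ A B)

  triangle : ∀ (T₁ T₂ T₃ : UBTree n) → d T₁ T₃ ≤ d T₁ T₂ + d T₂ T₃
  triangle T₁ T₂ T₃ = d-lub T₁ T₃ _ λ A B → ≤-trans (∣-∣-triangle (ε T₁ A B) (ε T₂ A B) (ε T₃ A B))
    (+-mono-≤ (discrepancy≤d T₁ T₂ A B) (discrepancy≤d T₂ T₃ A B))
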